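{- If $\Gamma;\Delta\vdash t:A$ is derivable in $\mathbf{DLAL_B}$, then $(\Gamma)^*,(\Delta)^*\vdash_F (t)^*:(A)^*$ is derivable in System F.
   Context: System $\mathbf{DLAL_B}$. Types: $A,B::=\alpha\mid A\multimap B\mid A\Rightarrow B\mid \S A\mid \forall\alpha.A\mid \mathbf{Bool}$. Terms of $\Lambda_B$: $t,u,v::=x\mid F\mid T\mid \lambda x.t\mid t\,u\mid \mathrm{if}\ t\ \mathrm{then}\ u\ \mathrm{else}\ v$. Judgements are $\Gamma;\Delta\vdash t:A$ where $\Gamma$ (non-linear) and $\Delta$ (linear) assign types to distinct variables, with disjoint domains. Rules: (Id) $;x:A\vdash x:A$. ($\multimap$i) from $\Gamma;\Delta,x:A\vdash t:B$ infer $\Gamma;\Delta\vdash\lambda x.t:A\multimap B$. ($\multimap$e) from $\Gamma_1;\Delta_1\vdash t:A\multimap B$ and $\Gamma_2;\Delta_2\vdash u:A$ infer $\Gamma_1,\Gamma_2;\Delta_1,\Delta_2\vdash t\,u:B$. ($\Rightarrow$i) from $\Gamma,x:A;\Delta\vdash t:B$ infer $\Gamma;\Delta\vdash \lambda x.t:A\Rightarrow B$. ($\Rightarrow$e) from $\Gamma;\Delta\vdash t:A\Rightarrow B$ and $;z:C\vdash u:A$ infer $\Gamma,z:C;\Delta\vdash t\,u:B$ (the right premise may also be $;\vdash u:A$, with conclusion $\Gamma;\Delta\vdash t\,u:B$). (Weak) from $\Gamma_1;\Delta_1\vdash t:A$ infer $\Gamma_1,\Gamma_2;\Delta_1,\Delta_2\vdash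 t:A$. (Cntr) from $x_1:A,x_2:A,\Gamma;\Delta\vdash t:B$ infer $x:A,\Gamma;\Delta\vdash t[x/x_1,x/x_2]:B$. ($\S$i) from $;\Gamma,\Delta\vdash t:A$ infer $\Gamma;\S\Delta\vdash t:\S A$ ($\S\Delta$ prefixes $\S$ to every type of $\Delta$). ($\S$e) from $\Gamma_1;\Delta_1\vdash u:\S A$ and $\Gamma_2;x:\S A,\Delta_2\vdash t:B$ infer $\Gamma_1,\Gamma_2;\Delta_1,\Delta_2\vdash t[u/x]:B$. ($\forall$i) from $\Gamma;\Delta\vdash t:A$ infer $\Gamma;\Delta\vdash t:\forall\alpha.A$ if $\alpha$ is not free in $\Gamma,\Delta$. ($\forall$e) from $\Gamma;\Delta\vdash t:\forall\alpha.A$ infer $\Gamma;\Delta\vdash t:A[B/\alpha]$. ($B_0$i) $;\vdash F:\mathbf{Bool}$; ($B_1$i) $;\vdash T:\mathbf{Bool}$. ($B$e) from $\Gamma;\Delta\vdash M_0:\S^k\mathbf{Bool}$ ($k\in\mathbb{N}$), $\Gamma;\Delta\vdash M_1:A$, $\Gamma;\Delta\vdash M_2:A$ infer $\Gamma;\Delta\vdash \mathrm{if}\ M_0\ \mathrm{then}\ M_1\ \mathrm{else}\ M_2:A$. Translation to System F (judgements $\Gamma\vdash_F t:A$): on types, $(\alpha)^*=\alpha$, $(A\multimap B)^*=(A\Rightarrow B)^*=(A)^*\to(B)^*$, $(\S A)^*=(A)^*$, $(\forall\alpha.A)^*=\forall\alpha.(A)^*$, $(\mathbf{Bool})^*=\forall\alpha.\alpha\to\alpha\to\alpha$;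 on terms (into the pure $\lambda$-calculus), $(x)^*=x$, $(F)^*=\lambda x.\lambda y.y$, $(T)^*=\lambda x.\lambda y.x$, $(\lambda x.t)^*=\lambda x.(t)^*$, $(t\,u)^*=(t)^*(u)^*$, $(\mathrm{if}\ t\ \mathrm{then}\ u\ \mathrm{else}\ v)^*=(t)^*(u)^*(v)^*$; on declarations, pointwise on the types. -}

module Defs where

open import Data.Nat using (ℕ; zero; suc; _⊔_; _≡ᵇ_)
open import Data.Bool using (if_then_else_)
open import Data.List using (List; []; _∷_; _++_; map; foldr; concatMap)
open import Data.List.Relation.Unary.Unique.Propositional using (Unique)
open import Data.List.Relation.Binary.Permutation.Propositional using (_↭_)
open import Data.Product using (_×_; _,_; proj₁; proj₂)
open import Relation.Binary.PropositionalEquality using (_≢_)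

-- DLAL_B types (type variables as de Bruijn indices)

infixr 20 _⊸_ _⇒_

data Ty : Set where
  tv  : ℕ → Ty
  _⊸_ : Ty → Ty → Ty
  _⇒_ : Ty → Ty → Ty
  §   : Ty → Ty
  ∀'  : Ty → Ty          -- ∀ binds de Bruijn index 0
  𝔹   : Ty

ext : (ℕ → ℕ) → ℕ → ℕ
ext ρ zero    = zero
ext ρ (suc n) = suc (ρ n)

tren : (ℕ → ℕ) → Ty → Ty
tren ρ (tv n)  = tv (ρ n)
tren ρ (A ⊸ B) = tren ρ A ⊸ tren ρ B
tren ρ (A ⇒ B) = tren ρ A ⇒ tren ρ B
tren ρ (§ A)   = § (tren ρ A)
tren ρ (∀' A)  = ∀' (tren (ext ρ) A)
tren ρ 𝔹       = 𝔹

tshift : Ty → Ty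
tshift = tren suc

exts : (ℕ → Ty) → ℕ → Ty
exts σ zero    = tv zero
exts σ (suc n) = tshift (σ n)

tsub : (ℕ → Ty) → Ty → Ty
tsub σ (tv n)  = σ n
tsub σ (A ⊸ B) = tsub σ A ⊸ tsub σ B
tsub σ (A ⇒ B) = tsub σ A ⇒ tsub σ B
tsub σ (§ A)   = § (tsub σ A)
tsub σ (∀' A)  = ∀' (tsub (exts σ) A)
tsub σ 𝔹       = 𝔹

sub0 : Ty → ℕ → Ty
sub0 B zero    = B
sub0 B (suc n) = tv n

_[_]₀ : Ty → Ty → Ty
A [ B ]₀ = tsub (sub0 B) A

§^ : ℕ → Ty → Ty
§^ zero    A = A
§^ (suc k) A = § (§^ k A)

-- Terms of Λ_B (named variables)

data Tm : Set where
  var : ℕ → Tm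
  Fᵇ  : Tm
  Tᵇ  : Tm
  lam : ℕ → Tm → Tm
  app : Tm → Tm → Tm
  ite : Tm → Tm → Tm → Tm

remove : ℕ → List ℕ → List ℕ
remove x []       = []
remove x (y ∷ ys) = if y ≡ᵇ x then remove x ys else y ∷ remove x ys

fv : Tm → List ℕ
fv (var x)     = x ∷ []
fv Fᵇ          = []
fv Tᵇ          = []
fv (lam x t)   = remove x (fv t)
fv (app t u)   = fv t ++ fv u
fv (ite t u v) = fv t ++ fv u ++ fv v

maxL : List ℕ → ℕ
maxL = foldr _⊔_ 0

_▹_↦_ : (ℕ → Tm) → ℕ → Tm → (ℕ → Tm)
(σ ▹ x ↦ u) z = if z ≡ᵇ x then u else σ z

-- capture-avoiding simultaneous substitution (bound variables are
-- renamed to a name fresh for all σ z, z free in the abstraction)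
subst : (ℕ → Tm) → Tm → Tm
subst σ (var x)     = σ x
subst σ Fᵇ          = Fᵇ
subst σ Tᵇ          = Tᵇ
subst σ (lam x t)   =
  let y = suc (maxL (concatMap (λ z → fv (σ z)) (remove x (fv t))))
  in lam y (subst (σ ▹ x ↦ var y) t)
subst σ (app t u)   = app (subst σ t) (subst σ u)
subst σ (ite t u v) = ite (subst σ t) (subst σ u) (subst σ v)

_[_/_] : Tm → Tm → ℕ → Tm
t [ u / x ] = subst (var ▹ x ↦ u) t

cntrSub : Tm → ℕ → ℕ → ℕ → Tm
cntrSub t x x₁ x₂ = subst ((var ▹ x₁ ↦ var x) ▹ x₂ ↦ var x) t

Ctx : Set
Ctx = List (ℕ × Ty)

dom : Ctx → List ℕ
dom = map proj₁

WF : Ctx → Ctx → Set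
WF Γ Δ = Unique (dom Γ ++ dom Δ)

§ctx : Ctx → Ctx
§ctx = map (λ p → proj₁ p , § (proj₂ p))

shiftCtx : Ctx → Ctx
shiftCtx = map (λ p → proj₁ p , tshift (proj₂ p))

infix 4 _︔_⊢_∶_

data _︔_⊢_∶_ : Ctx → Ctx → Tm → Ty → Set where
  Id   : ∀ x A → [] ︔ (x , A) ∷ [] ⊢ var x ∶ A
  -- contexts are finite assignments, i.e. taken up to permutation
  Exch : ∀ {Γ Γ' Δ Δ' t A} → Γ ↭ Γ' → Δ ↭ Δ' →
         Γ ︔ Δ ⊢ t ∶ A → Γ' ︔ Δ' ⊢ t ∶ A
  ⊸i   : ∀ {Γ Δ x t A B} → Γ ︔ (x , A) ∷ Δ ⊢ t ∶ B →
         Γ ︔ Δ ⊢ lam x t ∶ A ⊸ B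
  ⊸e   : ∀ {Γ₁ Γ₂ Δ₁ Δ₂ t u A B} →
         Γ₁ ︔ Δ₁ ⊢ t ∶ A ⊸ B → Γ₂ ︔ Δ₂ ⊢ u ∶ A →
         WF (Γ₁ ++ Γ₂) (Δ₁ ++ Δ₂) →
         Γ₁ ++ Γ₂ ︔ Δ₁ ++ Δ₂ ⊢ app t u ∶ B
  ⇒i   : ∀ {Γ Δ x t A B} → (x , A) ∷ Γ ︔ Δ ⊢ t ∶ B →
         Γ ︔ Δ ⊢ lam x t ∶ A ⇒ B
  ⇒e   : ∀ {Γ Δ z C t u A B} →
         Γ ︔ Δ ⊢ t ∶ A ⇒ B → [] ︔ (z , C) ∷ [] ⊢ u ∶ A →
         WF ((z , C) ∷ Γ) Δ →
         (z , C) ∷ Γ ︔ Δ ⊢ app t u ∶ B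
  ⇒e₀  : ∀ {Γ Δ t u A B} →
         Γ ︔ Δ ⊢ t ∶ A ⇒ B → [] ︔ [] ⊢ u ∶ A →
         Γ ︔ Δ ⊢ app t u ∶ B
  Weak : ∀ {Γ₁ Γ₂ Δ₁ Δ₂ t A} →
         Γ₁ ︔ Δ₁ ⊢ t ∶ A → WF (Γ₁ ++ Γ₂) (Δ₁ ++ Δ₂) →
         Γ₁ ++ Γ₂ ︔ Δ₁ ++ Δ₂ ⊢ t ∶ A
  Cntr : ∀ {x x₁ x₂ Γ Δ t A B} →
         (x₁ , A) ∷ (x₂ , A) ∷ Γ ︔ Δ ⊢ t ∶ B →
         WF ((x , A) ∷ Γ) Δ →
         (x , A) ∷ Γ ︔ Δ ⊢ cntrSub t x x₁ x₂ ∶ B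
  §i   : ∀ {Γ Δ t A} → [] ︔ Γ ++ Δ ⊢ t ∶ A →
         Γ ︔ §ctx Δ ⊢ t ∶ § A
  §e   : ∀ {Γ₁ Γ₂ Δ₁ Δ₂ x t u A B} →
         Γ₁ ︔ Δ₁ ⊢ u ∶ § A → Γ₂ ︔ (x , § A) ∷ Δ₂ ⊢ t ∶ B →
         WF (Γ₁ ++ Γ₂) (Δ₁ ++ Δ₂) →
         Γ₁ ++ Γ₂ ︔ Δ₁ ++ Δ₂ ⊢ t [ u / x ] ∶ B
  -- de Bruijn form of the side condition "α not free in Γ, Δ"
  ∀i   : ∀ {Γ Δ t A} → shiftCtx Γ ︔ shiftCtx Δ ⊢ t ∶ A →
         Γ ︔ Δ ⊢ t ∶ ∀' A
  ∀e   : ∀ {Γ Δ t A} B → Γ ︔ Δ ⊢ t ∶ ∀' A →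
         Γ ︔ Δ ⊢ t ∶ A [ B ]₀
  B₀i  : [] ︔ [] ⊢ Fᵇ ∶ 𝔹
  B₁i  : [] ︔ [] ⊢ Tᵇ ∶ 𝔹
  Be   : ∀ {Γ Δ M₀ M₁ M₂ A} k →
         Γ ︔ Δ ⊢ M₀ ∶ §^ k 𝔹 → Γ ︔ Δ ⊢ M₁ ∶ A → Γ ︔ Δ ⊢ M₂ ∶ A →
         Γ ︔ Δ ⊢ ite M₀ M₁ M₂ ∶ A

-- System F (Curry style, pure λ-terms)

infixr 20 _⟶_

data FTy : Set where
  ftv : ℕ → FTy
  _⟶_ : FTy → FTy → FTy
  ∀F  : FTy → FTy

ftren : (ℕ → ℕ) → FTy → FTy
ftren ρ (ftv n) = ftv (ρ n)
ftren ρ (A ⟶ B) = ftren ρ A ⟶ ftren ρ B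
ftren ρ (∀F A)  = ∀F (ftren (ext ρ) A)

fshift : FTy → FTy
fshift = ftren suc

fexts : (ℕ → FTy) → ℕ → FTy
fexts σ zero    = ftv zero
fexts σ (suc n) = fshift (σ n)

ftsub : (ℕ → FTy) → FTy → FTy
ftsub σ (ftv n) = σ n
ftsub σ (A ⟶ B) = ftsub σ A ⟶ ftsub σ B
ftsub σ (∀F A)  = ∀F (ftsub (fexts σ) A)

fsub0 : FTy → ℕ → FTy
fsub0 B zero    = B
fsub0 B (suc n) = ftv n

_[_]F : FTy → FTy → FTy
A [ B ]F = ftsub (fsub0 B) A

data Λ : Set where
  `_  : ℕ → Λ
  ƛ   : ℕ → Λ → Λ
  _·_ : Λ → Λ → Λ

FCtx : Set
FCtx = List (ℕ × FTy)

-- variable lookup (the rightmost/innermost binding of x, i.e. the first in the list)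
data _∋_∶_ : FCtx → ℕ → FTy → Set where
  here  : ∀ {Γ x A} → ((x , A) ∷ Γ) ∋ x ∶ A
  there : ∀ {Γ x y A B} → y ≢ x → Γ ∋ x ∶ A → ((y , B) ∷ Γ) ∋ x ∶ A

fshiftCtx : FCtx → FCtx
fshiftCtx = map (λ p → proj₁ p , fshift (proj₂ p))

infix 4 _⊢F_∶_

data _⊢F_∶_ : FCtx → Λ → FTy → Set where
  var : ∀ {Γ x A} → Γ ∋ x ∶ A → Γ ⊢F ` x ∶ A
  abs : ∀ {Γ x t A B} → (x , A) ∷ Γ ⊢F t ∶ B → Γ ⊢F ƛ x t ∶ A ⟶ B
  app : ∀ {Γ t u A B} → Γ ⊢F t ∶ A ⟶ B → Γ ⊢F u ∶ A → Γ ⊢F t · u ∶ B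
  gen : ∀ {Γ t A} → fshiftCtx Γ ⊢F t ∶ A → Γ ⊢F t ∶ ∀F A
  ins : ∀ {Γ t A} B → Γ ⊢F t ∶ ∀F A → Γ ⊢F t ∶ A [ B ]F

BoolF : FTy
BoolF = ∀F (ftv 0 ⟶ ftv 0 ⟶ ftv 0)

tyˢ : Ty → FTy
tyˢ (tv n)  = ftv n
tyˢ (A ⊸ B) = tyˢ A ⟶ tyˢ B
tyˢ (A ⇒ B) = tyˢ A ⟶ tyˢ B
tyˢ (§ A)   = tyˢ A
tyˢ (∀' A)  = ∀F (tyˢ A)
tyˢ 𝔹       = BoolF

tmˢ : Tm → Λ
tmˢ (var x)     = ` x
tmˢ Fᵇ          = ƛ 0 (ƛ 1 (` 1))
tmˢ Tᵇ          = ƛ 0 (ƛ 1 (` 0))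
tmˢ (lam x t)   = ƛ x (tmˢ t)
tmˢ (app t u)   = tmˢ t · tmˢ u
tmˢ (ite t u v) = (tmˢ t · tmˢ u) · tmˢ v

ctxˢ : Ctx → FCtx
ctxˢ = map (λ p → proj₁ p , tyˢ (proj₂ p))

module Submission where

-- (_)* erases § and the linear/non-linear distinction, so each DLAL_B rule
-- becomes a System F rule once three structural facts about (Curry-style,
-- named) System F are established, after some list and type algebra:
--   * type renaming: derivations survive renaming of type variables (∀i);
--   * context agreement: a derivation depends only on the bindings of its
--     free variables, so it moves to duplicate-free supercontexts and to
--     permutations of duplicate-free contexts (Exch, Weak, splitting rules);
--   * substitution: a capture-avoiding substitution well typed on the free
--     variables of t preserves the type of (t)* (Cntr and §e).
-- On types, (_)* commutes with substitution (∀e) and sends every §^k 𝔹 to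
-- the Church booleans (Be).  The theorem is an induction on DLAL_B
-- derivations that also records that the translated context is duplicate-free.

open import Defs
open import Data.Bool using (true; false)
open import Data.Empty using (⊥-elim)
open import Data.List using (List; []; _∷_; _++_; map; concatMap)
open import Data.List.Properties using (map-++; map-∘; map-cong; ++-assoc)
open import Data.List.Membership.Propositional using (_∈_)
open import Data.List.Membership.Propositional.Properties using (∈-concatMap⁺)
open import Data.List.Relation.Unary.Any using (here; there)
import Data.List.Relation.Unary.Any as Any
open import Data.List.Relation.Unary.All using (All; []; _∷_)
open import Data.List.Relation.Unary.AllPairs using ([]; _∷_)
open import Data.List.Relation.Unary.Unique.Propositional using (Unique)
open import Data.List.Relation.Binary.Subset.Propositional using (_⊆_)
import Data.List.Relation.Binary.Subset.Propositional.Properties as Sub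
open import Data.List.Relation.Binary.Permutation.Propositional using (_↭_; swap; ↭⇒↭ₛ)
  renaming (refl to ↭-refl)
import Data.List.Relation.Binary.Permutation.Propositional.Properties as Perm
import Data.List.Relation.Binary.Permutation.Setoid.Properties as PermSetoid
open import Data.Nat using (ℕ; zero; suc; _≡ᵇ_; _≤_; s≤s)
open import Data.Nat.Properties using (≡ᵇ⇒≡; ≡⇒≡ᵇ; m≤m⊔n; m≤n⊔m; ≤-trans; n≮n)
open import Data.Product using (Σ; _×_; _,_; proj₁; proj₂)
open import Function using (_∘_)
open import Relation.Binary.PropositionalEquality
  using (_≡_; _≢_; refl; sym; trans; cong; cong₂; setoid) renaming (subst to transport)

Unique-resp-↭ : {A : Set} {xs ys : List A} → xs ↭ ys → Unique xs → Unique ys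
Unique-resp-↭ {A} π = PermSetoid.Unique-resp-↭ (setoid A) (↭⇒↭ₛ π)

∈-remove⁺ : ∀ {z x} xs → z ∈ xs → z ≢ x → z ∈ remove x xs
∈-remove⁺ {x = x} (y ∷ ys) z∈ z≢x with y ≡ᵇ x | ≡ᵇ⇒≡ y x
∈-remove⁺ (y ∷ ys) (here refl) z≢x | true | y≡x = ⊥-elim (z≢x (y≡x _))
∈-remove⁺ (y ∷ ys) (there z∈) z≢x  | true | _   = ∈-remove⁺ ys z∈ z≢x
∈-remove⁺ (y ∷ ys) (here refl) z≢x | false | _  = here refl
∈-remove⁺ (y ∷ ys) (there z∈) z≢x  | false | _  = there (∈-remove⁺ ys z∈ z≢x)

∈-remove⁻ : ∀ {z x} xs → z ∈ remove x xs → z ∈ xs × z ≢ x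
∈-remove⁻ {x = x} (y ∷ ys) z∈ with y ≡ᵇ x | ≡⇒≡ᵇ y x
∈-remove⁻ (y ∷ ys) z∈ | true | _ with ∈-remove⁻ ys z∈
... | z∈ys , z≢x = there z∈ys , z≢x
∈-remove⁻ (y ∷ ys) (here refl) | false | y≢x = here refl , y≢x
∈-remove⁻ (y ∷ ys) (there z∈) | false | _ with ∈-remove⁻ ys z∈
... | z∈ys , z≢x = there z∈ys , z≢x

remove-⊆ : ∀ {x xs ys} → xs ⊆ ys → remove x xs ⊆ remove x ys
remove-⊆ {xs = xs} {ys} xs⊆ys z∈ with ∈-remove⁻ xs z∈
... | z∈xs , z≢x = ∈-remove⁺ ys (xs⊆ys z∈xs) z≢x

-- `suc (maxL xs)` is a name not occurring in xs; `subst` relies on this to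
-- pick fresh bound variables.
maxL-upper : ∀ {w} xs → w ∈ xs → w ≤ maxL xs
maxL-upper (x ∷ xs) (here refl) = m≤m⊔n x (maxL xs)
maxL-upper (x ∷ xs) (there w∈)  = ≤-trans (maxL-upper xs w∈) (m≤n⊔m x (maxL xs))

suc-maxL-fresh : ∀ {w} xs → w ∈ xs → suc (maxL xs) ≢ w
suc-maxL-fresh xs w∈ refl = n≮n _ (s≤s (maxL-upper xs w∈))

▹-elim : ∀ σ x u z (P : Tm → Set) →
         (z ≡ x → P u) → (z ≢ x → P (σ z)) → P ((σ ▹ x ↦ u) z)
▹-elim σ x u z P at-x elsewhere with z ≡ᵇ x | ≡ᵇ⇒≡ z x | ≡⇒≡ᵇ z x
... | true  | z≡x | _   = at-x (z≡x _)
... | false | _   | z≢x = elsewhere z≢x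

fvΛ : Λ → List ℕ
fvΛ (` x)   = x ∷ []
fvΛ (ƛ x s) = remove x (fvΛ s)
fvΛ (s · u) = fvΛ s ++ fvΛ u

fvΛ-tmˢ : ∀ t → fvΛ (tmˢ t) ⊆ fv t
fvΛ-tmˢ (var x)     = λ z∈ → z∈
fvΛ-tmˢ Fᵇ          = λ ()
fvΛ-tmˢ Tᵇ          = λ ()
fvΛ-tmˢ (lam x t)   = remove-⊆ (fvΛ-tmˢ t)
fvΛ-tmˢ (app t u)   = Sub.++⁺ (fvΛ-tmˢ t) (fvΛ-tmˢ u)
fvΛ-tmˢ (ite t u v) =
  Sub.⊆-trans (Sub.++⁺ (Sub.++⁺ (fvΛ-tmˢ t) (fvΛ-tmˢ u)) (fvΛ-tmˢ v))
              (Sub.⊆-reflexive (++-assoc (fv t) (fv u) (fv v)))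

fdom : FCtx → List ℕ
fdom = map proj₁

Distinct : FCtx → Set
Distinct Θ = Unique (fdom Θ)

Distinct-↭ : ∀ {Θ Θ'} → Θ ↭ Θ' → Distinct Θ → Distinct Θ'
Distinct-↭ π = Unique-resp-↭ (Perm.map⁺ proj₁ π)

∋⇒∈ : ∀ {Θ z C} → Θ ∋ z ∶ C → (z , C) ∈ Θ
∋⇒∈ here          = here refl
∋⇒∈ (there _ z∋) = there (∋⇒∈ z∋)

∈⇒∋ : ∀ {Θ z C} → Distinct Θ → (z , C) ∈ Θ → Θ ∋ z ∶ C
∈⇒∋ (_ ∷ _)       (here refl) = here
∈⇒∋ (x∉ ∷ dist) (there z∈)  = there (≢-of x∉ z∈) (∈⇒∋ dist z∈)
  where
  ≢-of : ∀ {y Θ z C} → All (y ≢_) (fdom Θ) → (z , C) ∈ Θ → y ≢ z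
  ≢-of (y≢ ∷ _)   (here refl) = y≢
  ≢-of (_ ∷ y≢s) (there z∈)  = ≢-of y≢s z∈

∋-functional : ∀ {Θ z C C'} → Θ ∋ z ∶ C → Θ ∋ z ∶ C' → C ≡ C'
∋-functional here           here           = refl
∋-functional here           (there z≢z _) = ⊥-elim (z≢z refl)
∋-functional (there z≢z _) here           = ⊥-elim (z≢z refl)
∋-functional (there _ z∋)  (there _ z∋') = ∋-functional z∋ z∋'

∋-tail : ∀ {Θ x z A C} → ((x , A) ∷ Θ) ∋ z ∶ C → z ≢ x → Θ ∋ z ∶ C
∋-tail here          z≢x = ⊥-elim (z≢x refl)
∋-tail (there _ z∋) _   = z∋

mapC : (FTy → FTy) → FCtx → FCtx
mapC f = map (λ p → proj₁ p , f (proj₂ p))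

∋-mapC⁺ : ∀ {f Θ z C} → Θ ∋ z ∶ C → mapC f Θ ∋ z ∶ f C
∋-mapC⁺ here            = here
∋-mapC⁺ (there z≢ z∋) = there z≢ (∋-mapC⁺ z∋)

∋-mapC⁻ : ∀ {f z C} Θ → mapC f Θ ∋ z ∶ C → Σ FTy λ C₀ → Θ ∋ z ∶ C₀ × C ≡ f C₀
∋-mapC⁻ ((y , B) ∷ Θ) here = B , here , refl
∋-mapC⁻ ((y , B) ∷ Θ) (there z≢ z∋) with ∋-mapC⁻ Θ z∋
... | C₀ , z∋Θ , C≡ = C₀ , there z≢ z∋Θ , C≡

mapC-fuse : ∀ {f g h k} → (∀ A → f (g A) ≡ h (k A)) →
            ∀ Θ → mapC f (mapC g Θ) ≡ mapC h (mapC k Θ)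
mapC-fuse e []            = refl
mapC-fuse e ((x , A) ∷ Θ) = cong₂ _∷_ (cong (x ,_) (e A)) (mapC-fuse e Θ)

fdom-mapC : ∀ f Θ → fdom (mapC f Θ) ≡ fdom Θ
fdom-mapC f Θ = sym (map-∘ Θ)

ftren-cong : ∀ {ρ ρ'} → (∀ n → ρ n ≡ ρ' n) → ∀ A → ftren ρ A ≡ ftren ρ' A
ftren-cong h (ftv n) = cong ftv (h n)
ftren-cong h (A ⟶ B) = cong₂ _⟶_ (ftren-cong h A) (ftren-cong h B)
ftren-cong {ρ} {ρ'} h (∀F A) = cong ∀F (ftren-cong ext-h A)
  where
  ext-h : ∀ n → ext ρ n ≡ ext ρ' n
  ext-h zero    = refl
  ext-h (suc n) = cong suc (h n)

ftsub-cong : ∀ {σ σ'} → (∀ n → σ n ≡ σ' n) → ∀ A → ftsub σ A ≡ ftsub σ' A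
ftsub-cong h (ftv n) = h n
ftsub-cong h (A ⟶ B) = cong₂ _⟶_ (ftsub-cong h A) (ftsub-cong h B)
ftsub-cong {σ} {σ'} h (∀F A) = cong ∀F (ftsub-cong exts-h A)
  where
  exts-h : ∀ n → fexts σ n ≡ fexts σ' n
  exts-h zero    = refl
  exts-h (suc n) = cong fshift (h n)

ftren-∘ : ∀ ρ ρ' A → ftren ρ (ftren ρ' A) ≡ ftren (ρ ∘ ρ') A
ftren-∘ ρ ρ' (ftv n) = refl
ftren-∘ ρ ρ' (A ⟶ B) = cong₂ _⟶_ (ftren-∘ ρ ρ' A) (ftren-∘ ρ ρ' B)
ftren-∘ ρ ρ' (∀F A)  =
  cong ∀F (trans (ftren-∘ (ext ρ) (ext ρ') A) (ftren-cong ext-∘ A))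
  where
  ext-∘ : ∀ n → ext ρ (ext ρ' n) ≡ ext (ρ ∘ ρ') n
  ext-∘ zero    = refl
  ext-∘ (suc n) = refl

ftren-ftsub : ∀ ρ σ A → ftren ρ (ftsub σ A) ≡ ftsub (ftren ρ ∘ σ) A
ftren-ftsub ρ σ (ftv n) = refl
ftren-ftsub ρ σ (A ⟶ B) = cong₂ _⟶_ (ftren-ftsub ρ σ A) (ftren-ftsub ρ σ B)
ftren-ftsub ρ σ (∀F A)  =
  cong ∀F (trans (ftren-ftsub (ext ρ) (fexts σ) A) (ftsub-cong ext-exts A))
  where
  ext-exts : ∀ n → ftren (ext ρ) (fexts σ n) ≡ fexts (ftren ρ ∘ σ) n
  ext-exts zero    = refl
  ext-exts (suc n) = trans (ftren-∘ (ext ρ) suc (σ n)) (sym (ftren-∘ suc ρ (σ n)))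

ftsub-ftren : ∀ σ ρ A → ftsub σ (ftren ρ A) ≡ ftsub (σ ∘ ρ) A
ftsub-ftren σ ρ (ftv n) = refl
ftsub-ftren σ ρ (A ⟶ B) = cong₂ _⟶_ (ftsub-ftren σ ρ A) (ftsub-ftren σ ρ B)
ftsub-ftren σ ρ (∀F A)  =
  cong ∀F (trans (ftsub-ftren (fexts σ) (ext ρ) A) (ftsub-cong exts-ext A))
  where
  exts-ext : ∀ n → fexts σ (ext ρ n) ≡ fexts (σ ∘ ρ) n
  exts-ext zero    = refl
  exts-ext (suc n) = refl

ftren-inst : ∀ ρ A B → ftren ρ (A [ B ]F) ≡ ftren (ext ρ) A [ ftren ρ B ]F
ftren-inst ρ A B =
  trans (ftren-ftsub ρ (fsub0 B) A)
        (trans (ftsub-cong agree A) (sym (ftsub-ftren (fsub0 (ftren ρ B)) (ext ρ) A)))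
  where
  agree : ∀ n → ftren ρ (fsub0 B n) ≡ fsub0 (ftren ρ B) (ext ρ n)
  agree zero    = refl
  agree (suc n) = refl

tyˢ-ren : ∀ ρ A → tyˢ (tren ρ A) ≡ ftren ρ (tyˢ A)
tyˢ-ren ρ (tv n)  = refl
tyˢ-ren ρ (A ⊸ B) = cong₂ _⟶_ (tyˢ-ren ρ A) (tyˢ-ren ρ B)
tyˢ-ren ρ (A ⇒ B) = cong₂ _⟶_ (tyˢ-ren ρ A) (tyˢ-ren ρ B)
tyˢ-ren ρ (§ A)   = tyˢ-ren ρ A
tyˢ-ren ρ (∀' A)  = cong ∀F (tyˢ-ren (ext ρ) A)
tyˢ-ren ρ 𝔹       = refl

tyˢ-sub : ∀ σ A → tyˢ (tsub σ A) ≡ ftsub (tyˢ ∘ σ) (tyˢ A)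
tyˢ-sub σ (tv n)  = refl
tyˢ-sub σ (A ⊸ B) = cong₂ _⟶_ (tyˢ-sub σ A) (tyˢ-sub σ B)
tyˢ-sub σ (A ⇒ B) = cong₂ _⟶_ (tyˢ-sub σ A) (tyˢ-sub σ B)
tyˢ-sub σ (§ A)   = tyˢ-sub σ A
tyˢ-sub σ (∀' A)  = cong ∀F (trans (tyˢ-sub (exts σ) A) (ftsub-cong exts-ˢ (tyˢ A)))
  where
  exts-ˢ : ∀ n → tyˢ (exts σ n) ≡ fexts (tyˢ ∘ σ) n
  exts-ˢ zero    = refl
  exts-ˢ (suc n) = tyˢ-ren suc (σ n)
tyˢ-sub σ 𝔹       = refl

tyˢ-inst : ∀ A B → tyˢ (A [ B ]₀) ≡ tyˢ A [ tyˢ B ]F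
tyˢ-inst A B = trans (tyˢ-sub (sub0 B) A) (ftsub-cong sub0-ˢ (tyˢ A))
  where
  sub0-ˢ : ∀ n → tyˢ (sub0 B n) ≡ fsub0 (tyˢ B) n
  sub0-ˢ zero    = refl
  sub0-ˢ (suc n) = refl

tyˢ-§^𝔹 : ∀ k → tyˢ (§^ k 𝔹) ≡ BoolF
tyˢ-§^𝔹 zero    = refl
tyˢ-§^𝔹 (suc k) = tyˢ-§^𝔹 k

⊢F-ren : ∀ ρ {Θ s A} → Θ ⊢F s ∶ A → mapC (ftren ρ) Θ ⊢F s ∶ ftren ρ A
⊢F-ren ρ (var z∋)  = var (∋-mapC⁺ z∋)
⊢F-ren ρ (abs D)   = abs (⊢F-ren ρ D)
⊢F-ren ρ (app D E) = app (⊢F-ren ρ D) (⊢F-ren ρ E)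
⊢F-ren ρ {Θ} {s} (gen D) =
  gen (transport (λ Θ' → Θ' ⊢F s ∶ _) (mapC-fuse ext-shift Θ) (⊢F-ren (ext ρ) D))
  where
  ext-shift : ∀ A → ftren (ext ρ) (fshift A) ≡ fshift (ftren ρ A)
  ext-shift A = trans (ftren-∘ (ext ρ) suc A) (sym (ftren-∘ suc ρ A))
⊢F-ren ρ {Θ} {s} (ins {A = A} B D) =
  transport (mapC (ftren ρ) Θ ⊢F s ∶_) (sym (ftren-inst ρ A B))
            (ins (ftren ρ B) (⊢F-ren ρ D))

_≼_on_ : FCtx → FCtx → List ℕ → Set
Θ ≼ Θ' on xs = ∀ {z C} → z ∈ xs → Θ ∋ z ∶ C → Θ' ∋ z ∶ C

≼-shift : ∀ {Θ Θ' xs} → Θ ≼ Θ' on xs → fshiftCtx Θ ≼ fshiftCtx Θ' on xs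
≼-shift {Θ} agree z∈ z∋ with ∋-mapC⁻ Θ z∋
... | _ , z∋Θ , refl = ∋-mapC⁺ (agree z∈ z∋Θ)

⊢F-agree : ∀ {Θ Θ' s A} → Θ ⊢F s ∶ A → Θ ≼ Θ' on fvΛ s → Θ' ⊢F s ∶ A
⊢F-agree (var z∋) agree = var (agree (here refl) z∋)
⊢F-agree {Θ} {Θ'} (abs {x = x} {t = s} D) agree = abs (⊢F-agree D agree-under)
  where
  agree-under : ∀ {A} → ((x , A) ∷ Θ) ≼ ((x , A) ∷ Θ') on fvΛ s
  agree-under z∈ here            = here
  agree-under z∈ (there x≢z z∋) =
    there x≢z (agree (∈-remove⁺ (fvΛ s) z∈ (λ z≡x → x≢z (sym z≡x))) z∋)
⊢F-agree (app {t = s} D E) agree =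
  app (⊢F-agree D (agree ∘ Sub.xs⊆xs++ys (fvΛ s) _))
      (⊢F-agree E (agree ∘ Sub.xs⊆ys++xs _ (fvΛ s)))
⊢F-agree (gen D)   agree = gen (⊢F-agree D (≼-shift agree))
⊢F-agree (ins B D) agree = ins B (⊢F-agree D agree)

⊢F-⊆ : ∀ {Θ Θ' s A} → Θ ⊢F s ∶ A → Distinct Θ' → Θ ⊆ Θ' → Θ' ⊢F s ∶ A
⊢F-⊆ D dist Θ⊆Θ' = ⊢F-agree D (λ _ z∋ → ∈⇒∋ dist (Θ⊆Θ' (∋⇒∈ z∋)))

⊢F-↭ : ∀ {Θ Θ' s A} → Θ ⊢F s ∶ A → Distinct Θ → Θ ↭ Θ' → Θ' ⊢F s ∶ A
⊢F-↭ D dist π = ⊢F-⊆ D (Distinct-↭ π dist) (Perm.∈-resp-↭ π)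

_∶_⇛_on_ : (ℕ → Tm) → FCtx → FCtx → List ℕ → Set
σ ∶ Θ ⇛ Θ' on xs = ∀ {z C} → z ∈ xs → Θ ∋ z ∶ C → Θ' ⊢F tmˢ (σ z) ∶ C

⇛-⊆ : ∀ {σ Θ Θ' xs ys} → ys ⊆ xs → σ ∶ Θ ⇛ Θ' on xs → σ ∶ Θ ⇛ Θ' on ys
⇛-⊆ ys⊆xs σ-ok = σ-ok ∘ ys⊆xs

⇛-var : ∀ {Θ Θ' xs} → Distinct Θ' → Θ ⊆ Θ' → var ∶ Θ ⇛ Θ' on xs
⇛-var dist Θ⊆Θ' _ z∋ = var (∈⇒∋ dist (Θ⊆Θ' (∋⇒∈ z∋)))

⇛-▹ : ∀ {σ Θ Θ' x u A xs} → Θ' ⊢F tmˢ u ∶ A → σ ∶ Θ ⇛ Θ' on remove x xs →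
      (σ ▹ x ↦ u) ∶ (x , A) ∷ Θ ⇛ Θ' on xs
⇛-▹ {σ} {Θ' = Θ'} {x} {u} {xs = xs} u-ok σ-ok {z} {C} z∈ z∋ =
  ▹-elim σ x u z (λ v → Θ' ⊢F tmˢ v ∶ C) at-x
         (λ z≢x → σ-ok (∈-remove⁺ xs z∈ z≢x) (∋-tail z∋ z≢x))
  where
  at-x : z ≡ x → Θ' ⊢F tmˢ u ∶ C
  at-x refl = transport (Θ' ⊢F tmˢ u ∶_) (∋-functional here z∋) u-ok

-- The name `subst σ` gives to the bound variable of `lam x t`.
freshName : (ℕ → Tm) → ℕ → Tm → ℕ
freshName σ x t = suc (maxL (concatMap (λ z → fv (σ z)) (remove x (fv t))))

⇛-fresh : ∀ {σ Θ Θ' x t A} → σ ∶ Θ ⇛ Θ' on fv (lam x t) →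
          σ ∶ Θ ⇛ (freshName σ x t , A) ∷ Θ' on fv (lam x t)
⇛-fresh {σ} {x = x} {t} σ-ok {z} z∈ z∋ =
  ⊢F-agree (σ-ok z∈ z∋) (λ w∈ w∋ → there (fresh w∈) w∋)
  where
  fresh : ∀ {w} → w ∈ fvΛ (tmˢ (σ z)) → freshName σ x t ≢ w
  fresh w∈ = suc-maxL-fresh _
    (∈-concatMap⁺ (λ z → fv (σ z)) (Any.map (λ { refl → fvΛ-tmˢ (σ z) w∈ }) z∈))

-- Substitution lemma.  The induction is on the System F derivation of (t)*;
-- the equation tmˢ t ≡ s keeps its subject general, as ∀ rules need.
⊢F-subst : ∀ {Θ Θ' s B} → Θ ⊢F s ∶ B → ∀ t → tmˢ t ≡ s →
           ∀ σ → σ ∶ Θ ⇛ Θ' on fv t → Θ' ⊢F tmˢ (subst σ t) ∶ B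
⊢F-subst (var z∋) (var x) refl σ σ-ok = σ-ok (here refl) z∋
⊢F-subst D@(abs _) Fᵇ refl σ σ-ok = ⊢F-agree D (λ ())
⊢F-subst D@(abs _) Tᵇ refl σ σ-ok = ⊢F-agree D (λ ())
⊢F-subst (abs D) (lam x t) refl σ σ-ok =
  abs (⊢F-subst D t refl (σ ▹ x ↦ var (freshName σ x t))
                (⇛-▹ (var here) (⇛-fresh {x = x} {t} σ-ok)))
⊢F-subst (app D E) (app t u) refl σ σ-ok =
  app (⊢F-subst D t refl σ (⇛-⊆ (Sub.xs⊆xs++ys (fv t) (fv u)) σ-ok))
      (⊢F-subst E u refl σ (⇛-⊆ (Sub.xs⊆ys++xs (fv u) (fv t)) σ-ok))
⊢F-subst (app D E) (ite t u v) refl σ σ-ok =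
  app (⊢F-subst D (app t u) refl σ
         (⇛-⊆ (Sub.++⁺ʳ (fv t) (Sub.xs⊆xs++ys (fv u) (fv v))) σ-ok))
      (⊢F-subst E v refl σ
         (⇛-⊆ (Sub.⊆-trans (Sub.xs⊆ys++xs (fv v) (fv u)) (Sub.xs⊆ys++xs _ (fv t))) σ-ok))
⊢F-subst {Θ} (gen D) t e σ σ-ok = gen (⊢F-subst D t e σ σ-ok-shifted)
  where
  σ-ok-shifted : σ ∶ fshiftCtx Θ ⇛ fshiftCtx _ on fv t
  σ-ok-shifted z∈ z∋ with ∋-mapC⁻ Θ z∋
  ... | _ , z∋Θ , refl = ⊢F-ren suc (σ-ok z∈ z∋Θ)
⊢F-subst (ins B D) t e σ σ-ok = ins B (⊢F-subst D t e σ σ-ok)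
⊢F-subst (var _) Fᵇ          () _ _
⊢F-subst (var _) Tᵇ          () _ _
⊢F-subst (var _) (lam _ _)   () _ _
⊢F-subst (var _) (app _ _)   () _ _
⊢F-subst (var _) (ite _ _ _) () _ _
⊢F-subst (abs _) (var _)     () _ _
⊢F-subst (abs _) (app _ _)   () _ _
⊢F-subst (abs _) (ite _ _ _) () _ _
⊢F-subst (app _ _) (var _)   () _ _
⊢F-subst (app _ _) Fᵇ        () _ _
⊢F-subst (app _ _) Tᵇ        () _ _
⊢F-subst (app _ _) (lam _ _) () _ _

⊢F-subst₁ : ∀ {Θ Θ' x u t A B} → Distinct Θ' → Θ ⊆ Θ' → Θ' ⊢F tmˢ u ∶ A →
            (x , A) ∷ Θ ⊢F tmˢ t ∶ B → Θ' ⊢F tmˢ (t [ u / x ]) ∶ B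
⊢F-subst₁ {t = t} dist Θ⊆Θ' Du Dt =
  ⊢F-subst Dt t refl _ (⇛-▹ Du (⇛-var dist Θ⊆Θ'))

⊢F-contract : ∀ {Θ x x₁ x₂ t A B} →
              Distinct ((x₁ , A) ∷ (x₂ , A) ∷ Θ) → Distinct ((x , A) ∷ Θ) →
              (x₁ , A) ∷ (x₂ , A) ∷ Θ ⊢F tmˢ t ∶ B →
              (x , A) ∷ Θ ⊢F tmˢ (cntrSub t x x₁ x₂) ∶ B
⊢F-contract {t = t} dist₁₂ dist D =
  ⊢F-subst (⊢F-↭ D dist₁₂ (swap _ _ ↭-refl)) t refl _
           (⇛-▹ (var here) (⇛-▹ (var here) (⇛-var dist (Sub.xs⊆x∷xs _ _))))

⟦_︔_⟧ : Ctx → Ctx → FCtx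
⟦ Γ ︔ Δ ⟧ = ctxˢ Γ ++ ctxˢ Δ

ctxˢ-++ : ∀ Γ Δ → ctxˢ (Γ ++ Δ) ≡ ⟦ Γ ︔ Δ ⟧
ctxˢ-++ = map-++ _

ctxˢ-§ : ∀ Δ → ctxˢ (§ctx Δ) ≡ ctxˢ Δ
ctxˢ-§ Δ = sym (map-∘ Δ)

ctxˢ-shift : ∀ Γ → ctxˢ (shiftCtx Γ) ≡ fshiftCtx (ctxˢ Γ)
ctxˢ-shift Γ = trans (sym (map-∘ Γ))
  (trans (map-cong (λ p → cong (proj₁ p ,_) (tyˢ-ren suc (proj₂ p))) Γ) (map-∘ Γ))

WF⇒Distinct : ∀ {Γ Δ} → WF Γ Δ → Distinct ⟦ Γ ︔ Δ ⟧
WF⇒Distinct {Γ} {Δ} = transport Unique (sym fdom-⟦⟧)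
  where
  fdom-⟦⟧ : fdom ⟦ Γ ︔ Δ ⟧ ≡ dom Γ ++ dom Δ
  fdom-⟦⟧ = trans (map-++ proj₁ (ctxˢ Γ) (ctxˢ Δ))
                  (sym (cong₂ _++_ (map-∘ Γ) (map-∘ Δ)))

⟦⟧-⊆ˡ : ∀ Γ₁ Γ₂ Δ₁ Δ₂ → ⟦ Γ₁ ︔ Δ₁ ⟧ ⊆ ⟦ Γ₁ ++ Γ₂ ︔ Δ₁ ++ Δ₂ ⟧
⟦⟧-⊆ˡ Γ₁ Γ₂ Δ₁ Δ₂ =
  Sub.++⁺ (Sub.map⁺ _ (Sub.xs⊆xs++ys Γ₁ Γ₂)) (Sub.map⁺ _ (Sub.xs⊆xs++ys Δ₁ Δ₂))

⟦⟧-⊆ʳ : ∀ Γ₁ Γ₂ Δ₁ Δ₂ → ⟦ Γ₂ ︔ Δ₂ ⟧ ⊆ ⟦ Γ₁ ++ Γ₂ ︔ Δ₁ ++ Δ₂ ⟧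
⟦⟧-⊆ʳ Γ₁ Γ₂ Δ₁ Δ₂ =
  Sub.++⁺ (Sub.map⁺ _ (Sub.xs⊆ys++xs Γ₂ Γ₁)) (Sub.map⁺ _ (Sub.xs⊆ys++xs Δ₂ Δ₁))

⟦⟧-front : ∀ Γ x A Δ → ⟦ Γ ︔ (x , A) ∷ Δ ⟧ ↭ (x , tyˢ A) ∷ ⟦ Γ ︔ Δ ⟧
⟦⟧-front Γ x A Δ = Perm.shift (x , tyˢ A) (ctxˢ Γ) (ctxˢ Δ)

⟦⟧-tshift : ∀ Γ Δ → ⟦ shiftCtx Γ ︔ shiftCtx Δ ⟧ ≡ fshiftCtx ⟦ Γ ︔ Δ ⟧
⟦⟧-tshift Γ Δ =
  trans (cong₂ _++_ (ctxˢ-shift Γ) (ctxˢ-shift Δ)) (sym (map-++ _ (ctxˢ Γ) (ctxˢ Δ)))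

-- Every derivable judgement has a duplicate-free translated context (needed
-- to permute it) and a System F derivation of the translated judgement.
translation : ∀ {Γ Δ t A} → Γ ︔ Δ ⊢ t ∶ A →
              Distinct ⟦ Γ ︔ Δ ⟧ × ⟦ Γ ︔ Δ ⟧ ⊢F tmˢ t ∶ tyˢ A
translation (Id x A) = ([] ∷ []) , var here
translation (Exch Γ↭ Δ↭ d) with translation d
... | dist , D = Distinct-↭ π dist , ⊢F-↭ D dist π
  where π = Perm.++⁺ (Perm.map⁺ _ Γ↭) (Perm.map⁺ _ Δ↭)
translation (⊸i {Γ} {Δ} {x} {A = A} d) with translation d
... | dist , D with Distinct-↭ (⟦⟧-front Γ x A Δ) dist
...   | _ ∷ dist' = dist' , abs (⊢F-↭ D dist (⟦⟧-front Γ x A Δ))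
translation (⊸e {Γ₁} {Γ₂} {Δ₁} {Δ₂} d e wf) with translation d | translation e
... | _ , D | _ , E = dist , app (⊢F-⊆ D dist (⟦⟧-⊆ˡ Γ₁ Γ₂ Δ₁ Δ₂))
                                 (⊢F-⊆ E dist (⟦⟧-⊆ʳ Γ₁ Γ₂ Δ₁ Δ₂))
  where dist = WF⇒Distinct {Γ₁ ++ Γ₂} {Δ₁ ++ Δ₂} wf
translation (⇒i d) with translation d
... | _ ∷ dist , D = dist , abs D
translation (⇒e {Γ} {Δ} {z} {C} d e wf) with translation d | translation e
... | _ , D | _ , E = dist , app (⊢F-⊆ D dist (Sub.xs⊆x∷xs _ _))
                                 (⊢F-⊆ E dist (Sub.xs⊆xs++ys _ _))
  where dist = WF⇒Distinct {(z , C) ∷ Γ} {Δ} wf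
translation (⇒e₀ d e) with translation d | translation e
... | dist , D | _ , E = dist , app D (⊢F-⊆ E dist (λ ()))
translation (Weak {Γ₁} {Γ₂} {Δ₁} {Δ₂} d wf) with translation d
... | _ , D = dist , ⊢F-⊆ D dist (⟦⟧-⊆ˡ Γ₁ Γ₂ Δ₁ Δ₂)
  where dist = WF⇒Distinct {Γ₁ ++ Γ₂} {Δ₁ ++ Δ₂} wf
translation (Cntr {x} {Γ = Γ} {Δ = Δ} {A = A} d wf) with translation d
... | dist₁₂ , D = dist , ⊢F-contract dist₁₂ dist D
  where dist = WF⇒Distinct {(x , A) ∷ Γ} {Δ} wf
translation (§i {Γ} {Δ} {t} {A} d) =
  transport (λ Θ → Distinct Θ × Θ ⊢F tmˢ t ∶ tyˢ A) ctx-eq (translation d)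
  where
  ctx-eq : ctxˢ (Γ ++ Δ) ≡ ⟦ Γ ︔ §ctx Δ ⟧
  ctx-eq = trans (ctxˢ-++ Γ Δ) (cong (ctxˢ Γ ++_) (sym (ctxˢ-§ Δ)))
translation (§e {Γ₁} {Γ₂} {Δ₁} {Δ₂} {x} {A = A} du dt wf)
  with translation du | translation dt
... | _ , Du | dist₂ , Dt =
  dist , ⊢F-subst₁ dist (⟦⟧-⊆ʳ Γ₁ Γ₂ Δ₁ Δ₂) (⊢F-⊆ Du dist (⟦⟧-⊆ˡ Γ₁ Γ₂ Δ₁ Δ₂))
                   (⊢F-↭ Dt dist₂ (⟦⟧-front Γ₂ x (§ A) Δ₂))
  where dist = WF⇒Distinct {Γ₁ ++ Γ₂} {Δ₁ ++ Δ₂} wf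
translation (∀i {Γ} {Δ} {t} {A} d)
  with transport (λ Θ → Distinct Θ × Θ ⊢F tmˢ t ∶ tyˢ A) (⟦⟧-tshift Γ Δ) (translation d)
... | dist , D = transport Unique (fdom-mapC fshift ⟦ Γ ︔ Δ ⟧) dist , gen D
translation (∀e {A = A} B d) with translation d
... | dist , D = dist , transport (_ ⊢F _ ∶_) (sym (tyˢ-inst A B)) (ins (tyˢ B) D)
translation B₀i = [] , gen (abs (abs (var here)))
translation B₁i = [] , gen (abs (abs (var (there (λ ()) here))))
translation (Be {A = A} k d₀ d₁ d₂) with translation d₀ | translation d₁ | translation d₂
... | dist , D₀ | _ , D₁ | _ , D₂ =
  dist , app (app (ins (tyˢ A) (transport (_ ⊢F _ ∶_) (tyˢ-§^𝔹 k) D₀)) D₁) D₂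

lemma2 : ∀ {Γ Δ t A} → Γ ︔ Δ ⊢ t ∶ A → ctxˢ Γ ++ ctxˢ Δ ⊢F tmˢ t ∶ tyˢ A
lemma2 d = proj₂ (translation d)
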